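{- (a) Assume Conjecture A (stated in the context). Then for every integer $n\ge 1$, the sequence of iterates $(S_{2,3}^k(n))_{k\ge0}$ eventually reaches a cycle or a fixed point of $S_{2,3}$. (b) Assume Conjecture B (stated in the context). Then for every integer $b\ge 4$ and every integer $n\ge1$, the sequence of iterates $(S_{2,b}^k(n))_{k\ge0}$ eventually reaches a cycle or a fixed point of $S_{2,b}$.
   Context: For integers $t\ge 0$, $b\ge 2$, the $t$-shifted Sloane map in base $b$ is $S_{t,b}(n)=\prod_{i=0}^k (d_i+t)$, where $n=\sum_{i=0}^k d_ib^i$ is the base-$b$ expansion of $n$ ($0\le d_i\le b-1$, $d_k>0$); $S_{t,b}^k$ is its $k$-th iterate. For a base $q$, a digit $d$ and a positive integer $n$, $\#d(n)_q$ is the number of occurrences of $d$ in the base-$q$ expansion of $n$ and $\#(n)_q$ the number of base-$q$ digits of $n$. Given $\varepsilon>0$, $n$ is $\varepsilon$-equidistributed in base $q$ if $\left|\frac{\#d(n)_q}{\#(n)_q}-\frac1q\right|<\varepsilon$ for every $d\in\{0,\dots,q-1\}$. Conjecture A: For every integer $q>1$, every finite set $F$ of primes that does not contain all primes dividing $q$, and every positive integer $a$, if $N_0=a$ and $N_{k+1}=N_kp_k$ with $p_k\in F$ for all $k\ge0$, then for every $\varepsilon>0$ there is $n_0$ such that $N_n$ is $\varepsilon$-equidistributed in base $q$ for all $n\ge n_0$. Conjecture B: For every integer $q>1$, every finite set $F=\{p_1,\dots,p_k\}$ of primes that does not contain all primes dividing $q$, and every positive integer $a$, for every $\varepsilon>0$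 there exists $N$ such that $a\prod_{i=1}^k p_i^{\alpha_i}$ (nonnegative integers $\alpha_i$) is $\varepsilon$-equidistributed in base $q$ whenever $\alpha_i\ge N$ for some $i$. -}

module Defs where

open import Data.Nat as ℕ using (ℕ; zero; suc; _+_; _*_; _^_; _≤_; _<_; _/_; _%_; _≟_)
open import Data.Nat.Divisibility using (_∣_)
open import Data.Nat.Primality using (Prime)
open import Data.Integer using (+_)
open import Data.Rational as ℚ using (ℚ; 0ℚ; ∣_∣; _-_; Positive)
open import Data.List using (List; []; _∷_; length; filter; map; tabulate)
open import Data.Nat.ListAction using (product)
open import Data.List.Relation.Unary.All using (All)
open import Data.List.Membership.Propositional using (_∈_)
open import Data.Fin using (Fin)
open import Data.Product using (Σ; ∃; ∃-syntax; _×_)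
open import Relation.Nullary using (¬_)
open import Relation.Binary.PropositionalEquality using (_≡_)
open import Function.Definitions using (Injective)

-- Base-b digits of n, least significant first (d_0, d_1, ..., d_k), with d_k > 0.
-- The fuel argument (initialised to n) is always sufficient when b ≥ 2.
-- Only meaningful for b ≥ 2; for n = 0 the expansion is empty.
digitsAux : (b : ℕ) → .{{ℕ.NonZero b}} → ℕ → ℕ → List ℕ
digitsAux b zero n = []
digitsAux b (suc f) zero = []
digitsAux b (suc f) (suc n) = (suc n % b) ∷ digitsAux b f (suc n / b)

digits : ℕ → ℕ → List ℕ
digits zero n = []
digits (suc b) n = digitsAux (suc b) n n

S : ℕ → ℕ → ℕ → ℕ
S t b n = product (map (_+ t) (digits b n))

iter : (ℕ → ℕ) → ℕ → ℕ → ℕ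
iter f zero n = n
iter f (suc k) n = f (iter f k n)

countDigit : ℕ → ℕ → ℕ → ℕ
countDigit q d n = length (filter (_≟ d) (digits q n))

numDigits : ℕ → ℕ → ℕ
numDigits q n = length (digits q n)

-- the rational number a / m (m > 0; junk value 0 when m = 0)
ratio : ℕ → ℕ → ℚ
ratio a zero = 0ℚ
ratio a (suc m) = (+ a) ℚ./ suc m

Equidistributed : ℕ → ℚ → ℕ → Set
Equidistributed q ε n =
  (d : ℕ) → d < q → ∣ ratio (countDigit q d n) (numDigits q n) - ratio 1 q ∣ ℚ.< ε

ConjectureA : Set
ConjectureA =
  (q : ℕ) → 1 < q →
  (F : List ℕ) → All Prime F →
  ¬ ((p : ℕ) → Prime p → p ∣ q → p ∈ F) →
  (a : ℕ) → 0 < a →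
  (N : ℕ → ℕ) → N 0 ≡ a →
  ((k : ℕ) → ∃[ p ] (p ∈ F × N (suc k) ≡ N k * p)) →
  (ε : ℚ) → Positive ε →
  ∃[ n₀ ] ((n : ℕ) → n₀ ≤ n → Equidistributed q ε (N n))

-- Conjecture B  (F = {p_1, ..., p_k} given as an injective family Fin k → ℕ)
ConjectureB : Set
ConjectureB =
  (q : ℕ) → 1 < q →
  (k : ℕ) (p : Fin k → ℕ) → Injective _≡_ _≡_ p → ((i : Fin k) → Prime (p i)) →
  ¬ ((r : ℕ) → Prime r → r ∣ q → ∃[ i ] (p i ≡ r)) →
  (a : ℕ) → 0 < a →
  (ε : ℚ) → Positive ε →
  ∃[ N ] ((α : Fin k → ℕ) → ∃[ i ] (N ≤ α i) →
    Equidistributed q ε (a * product (tabulate (λ i → p i ^ α i))))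

-- the orbit of n under f eventually reaches a cycle or fixed point:
-- some iterate f^j(n) is periodic with period m ≥ 1 (m = 1 is a fixed point)
ReachesCycle : (ℕ → ℕ) → ℕ → Set
ReachesCycle f n = ∃[ j ] ∃[ m ] (1 ≤ m × iter f (j + m) n ≡ iter f j n)

{-# OPTIONS --safe #-}

-- Write S for S_{2,b}. Since S(bᵘ w) = 2ᵘ S(w), it is enough to exhibit a set P such that every value
-- of S is bᵘ w with w ∈ P, and S(w) < w for all large w ∈ P: then S(S m) < S m whenever S m is large,
-- so every orbit is bounded and hence eventually periodic. A long ε-equidistributed w has
-- S(w) ≈ ((b+1)!)^(L/b) < b^(L-1) ≤ w, because (b+1)! < b^b for b ≥ 3.
-- For b = 3 the values of S are 3^y 2^x, P is the powers of 2, and Conjecture A makes them equidistributed.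
-- For b ≥ 4 the values of S are products of primes ≤ b+1; dividing out b as often as possible leaves
-- w = ∏ pᵢ^zᵢ with some z_i₀ below the exponent of p_i₀ in b, and Conjecture B for the other primes,
-- with a = p_i₀^z_i₀, makes such w equidistributed once one of the other exponents is large.

module Submission where

open import Defs
open import Data.Nat
open import Data.Nat.Properties
open import Algebra.Properties.CommutativeSemigroup *-commutativeSemigroup using (interchange; x∙yz≈y∙xz)
open import Data.Nat.DivMod
open import Data.Nat.Divisibility using (_∣_; ∣-refl; ∣⇒≤; m∣m*n; ∣m⇒∣m*n)
open import Data.Nat.Induction using (<-rec)
open import Data.Nat.ListAction using (product)
open import Data.Nat.ListAction.Properties using (product-++; ∈⇒∣product)
open import Data.Nat.Primality using (Prime; prime?; prime⇒nonZero; prime[2])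
open import Data.Nat.Primality.Factorisation using (factorise; PrimeFactorisation)
open import Data.Nat.Tactic.RingSolver using (solve-∀)
open import Data.Integer as ℤ using (+_; -[1+_])
import Data.Integer.Properties as ℤ
open import Data.Rational as ℚ using (ℚ; Positive)
import Data.Rational.Properties as ℚ
import Data.Rational.Unnormalised as ℚᵘ
import Data.Rational.Unnormalised.Properties as ℚᵘ
open import Data.Fin using (Fin; zero; suc; toℕ; fromℕ<; punchIn; punchOut)
open import Data.Fin.Properties
  using (pigeonhole; toℕ-fromℕ<; toℕ<n; punchInᵢ≢i; punchIn-punchOut; punchIn-injective; all?; any?; ¬∀⟶∃¬)
open import Data.List using (List; []; _∷_; length; map; filter; replicate; _++_; tabulate; upTo; lookup)
open import Data.List.Properties using (map-++; filter-accept; filter-reject; tabulate-cong)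
open import Data.List.Relation.Unary.All as All using (All; []; _∷_)
import Data.List.Relation.Unary.All.Properties as All
open import Data.List.Relation.Unary.Any as Any using (here; there)
open import Data.List.Relation.Unary.Any.Properties using (lookup-index)
open import Data.List.Relation.Unary.AllPairs using (_∷_)
open import Data.List.Relation.Unary.Unique.Propositional using (Unique)
open import Data.List.Relation.Unary.Unique.Propositional.Properties using (upTo⁺; filter⁺)
open import Data.List.Membership.Propositional using (_∈_)
open import Data.List.Membership.Propositional.Properties using (∈-lookup; ∈-filter⁺; ∈-filter⁻; ∈-upTo⁺)
open import Data.Vec.Functional using (updateAt)
open import Data.Product using (∃; ∃-syntax; _×_; _,_; proj₁; proj₂)
open import Function using (_∘_; _∘′_)
open import Function.Definitions using (Injective)
open import Relation.Binary.PropositionalEquality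
open import Relation.Nullary using (yes; no; ¬_; contradiction)
open import Relation.Nullary.Decidable using (toWitness)

-- Base-b digits

digitsAux-fuel : ∀ {b} .{{_ : NonZero b}} → 1 < b →
                 ∀ {f f′} n → n ≤ f → n ≤ f′ → digitsAux b f n ≡ digitsAux b f′ n
digitsAux-fuel _ {zero}  {zero}   _       _         _         = refl
digitsAux-fuel _ {suc _} {zero}   zero    _         _         = refl
digitsAux-fuel _ {zero}  {suc _}  zero    _         _         = refl
digitsAux-fuel _ {suc _} {suc _}  zero    _         _         = refl
digitsAux-fuel {b} 1<b {suc f} {suc f′} (suc n) (s≤s n≤f) (s≤s n≤f′) =
  cong (suc n % b ∷_) (digitsAux-fuel 1<b (suc n / b) (≤-trans q≤n n≤f) (≤-trans q≤n n≤f′))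
  where
  q≤n : suc n / b ≤ n
  q≤n = ≤-pred (m/n<m (suc n) b 1<b)

digits-zero : ∀ b → digits b 0 ≡ []
digits-zero zero    = refl
digits-zero (suc b) = refl

digits-suc : ∀ {b} .{{_ : NonZero b}} → 1 < b → ∀ n →
             digits b (suc n) ≡ suc n % b ∷ digits b (suc n / b)
digits-suc {suc b} 1<b n =
  cong (suc n % suc b ∷_) (digitsAux-fuel 1<b (suc n / suc b) (≤-pred (m/n<m (suc n) (suc b) 1<b)) ≤-refl)

digits-b* : ∀ {b} .{{_ : NonZero b}} → 1 < b → ∀ w .{{_ : NonZero w}} →
            digits b (b * w) ≡ 0 ∷ digits b w
digits-b* {b} 1<b w with b * w in eq
... | zero  = contradiction eq (≢-nonZero⁻¹ (b * w) {{m*n≢0 b w}})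
... | suc n = begin
  digits b (suc n)                       ≡⟨ digits-suc 1<b n ⟩
  suc n % b ∷ digits b (suc n / b)       ≡⟨ cong₂ (λ r q → r ∷ digits b q) (trans (cong (_% b) eq′) (m*n%n≡0 w b))
                                                                         (trans (cong (_/ b) eq′) (m*n/n≡m w b)) ⟩
  0 ∷ digits b w                         ∎
  where
  open ≡-Reasoning
  eq′ : suc n ≡ w * b
  eq′ = trans (sym eq) (*-comm b w)

digits-b^* : ∀ {b} .{{_ : NonZero b}} → 1 < b → ∀ u w .{{_ : NonZero w}} →
             digits b (b ^ u * w) ≡ replicate u 0 ++ digits b w
digits-b^* {b} 1<b zero w = cong (digits b) (+-identityʳ w)
digits-b^* {b} 1<b (suc u) w = begin
  digits b (b * b ^ u * w)     ≡⟨ cong (digits b) (*-assoc b (b ^ u) w) ⟩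
  digits b (b * (b ^ u * w))   ≡⟨ digits-b* 1<b (b ^ u * w) {{m*n≢0 (b ^ u) w {{m^n≢0 b u}}}} ⟩
  0 ∷ digits b (b ^ u * w)     ≡⟨ cong (0 ∷_) (digits-b^* 1<b u w) ⟩
  0 ∷ replicate u 0 ++ digits b w ∎
  where open ≡-Reasoning

S-b^* : ∀ t {b} .{{_ : NonZero b}} → 1 < b → ∀ u w .{{_ : NonZero w}} → S t b (b ^ u * w) ≡ t ^ u * S t b w
S-b^* t {b} 1<b u w = begin
  product (map (_+ t) (digits b (b ^ u * w)))                          ≡⟨ cong (product ∘ map (_+ t)) (digits-b^* 1<b u w) ⟩
  product (map (_+ t) (replicate u 0 ++ digits b w))                   ≡⟨ cong product (map-++ (_+ t) (replicate u 0) (digits b w)) ⟩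
  product (map (_+ t) (replicate u 0) ++ map (_+ t) (digits b w))      ≡⟨ product-++ (map (_+ t) (replicate u 0)) _ ⟩
  product (map (_+ t) (replicate u 0)) * S t b w                       ≡⟨ cong (_* S t b w) (product-replicate u) ⟩
  t ^ u * S t b w                                                      ∎
  where
  open ≡-Reasoning
  product-replicate : ∀ u → product (map (_+ t) (replicate u 0)) ≡ t ^ u
  product-replicate zero    = refl
  product-replicate (suc u) = cong (t *_) (product-replicate u)

digitsAux-< : ∀ {b} .{{_ : NonZero b}} f n → All (_< b) (digitsAux b f n)
digitsAux-< zero    n       = []
digitsAux-< (suc f) zero    = []
digitsAux-< {b} (suc f) (suc n) = m%n<n (suc n) b ∷ digitsAux-< f (suc n / b)

digits-< : ∀ b n → All (_< b) (digits b n)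
digits-< zero    n = []
digits-< (suc b) n = digitsAux-< n n

module _ {b} .{{_ : NonZero b}} (1<b : 1 < b) where

  private
    quotient< : ∀ n → suc n / b < suc n
    quotient< n = m/n<m (suc n) b 1<b

    length-digits-suc : ∀ n → length (digits b (suc n)) ≡ suc (length (digits b (suc n / b)))
    length-digits-suc n = cong length (digits-suc 1<b n)

  length-digits≤ : ∀ n → length (digits b n) ≤ n
  length-digits≤ = <-rec _ step
    where
    step : ∀ n → (∀ {m} → m < n → length (digits b m) ≤ m) → length (digits b n) ≤ n
    step zero    _   rewrite digits-zero b = z≤n
    step (suc n) rec = begin
      length (digits b (suc n))             ≡⟨ length-digits-suc n ⟩
      suc (length (digits b (suc n / b)))   ≤⟨ s≤s (rec (quotient< n)) ⟩
      suc (suc n / b)                       ≤⟨ quotient< n ⟩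
      suc n                                 ∎
      where open ≤-Reasoning

  <b^length-digits : ∀ n → n < b ^ length (digits b n)
  <b^length-digits = <-rec _ step
    where
    step : ∀ n → (∀ {m} → m < n → m < b ^ length (digits b m)) → n < b ^ length (digits b n)
    step zero    _   rewrite digits-zero b = z<s
    step (suc n) rec = begin-strict
      suc n                                ≡⟨ m≡m%n+[m/n]*n (suc n) b ⟩
      suc n % b + suc n / b * b            <⟨ +-monoˡ-< _ (m%n<n (suc n) b) ⟩
      b + suc n / b * b                    ≡⟨ *-comm (suc (suc n / b)) b ⟩
      b * suc (suc n / b)                  ≤⟨ *-monoʳ-≤ b (rec (quotient< n)) ⟩
      b * b ^ length (digits b (suc n / b)) ≡⟨ cong (b ^_) (length-digits-suc n) ⟨
      b ^ length (digits b (suc n))        ∎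
      where open ≤-Reasoning

  b^pred-length-digits≤ : ∀ n {L} → length (digits b n) ≡ suc L → b ^ L ≤ n
  b^pred-length-digits≤ = <-rec _ step
    where
    step : ∀ n → (∀ {m} → m < n → ∀ {L} → length (digits b m) ≡ suc L → b ^ L ≤ m) →
           ∀ {L} → length (digits b n) ≡ suc L → b ^ L ≤ n
    step zero    _   len rewrite digits-zero b = contradiction len λ ()
    step (suc n) _   {zero}  _   = s≤s z≤n
    step (suc n) rec {suc L} len = begin
      b * b ^ L          ≤⟨ *-monoʳ-≤ b (rec (quotient< n) (suc-injective (trans (sym (length-digits-suc n)) len))) ⟩
      b * (suc n / b)    ≡⟨ *-comm b (suc n / b) ⟩
      suc n / b * b      ≤⟨ m/n*n≤m (suc n) b ⟩
      suc n              ∎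
      where open ≤-Reasoning

-- Finite families and eventually periodic orbits

UpwardClosed : (ℕ → Set) → Set
UpwardClosed P = ∀ {m n} → m ≤ n → P m → P n

eventually-all : ∀ {k} (P : Fin k → ℕ → Set) → (∀ i → UpwardClosed (P i)) →
                 (∀ i → ∃ (P i)) → ∃[ N ] ∀ i → P i N
eventually-all {zero}  P _  _  = 0 , λ ()
eventually-all {suc k} P up ex with ex zero | eventually-all (P ∘ suc) (up ∘ suc) (ex ∘ suc)
... | N₀ , p₀ | N₁ , p₁ = N₀ ⊔ N₁ , λ where
  zero    → up zero (m≤m⊔n N₀ N₁) p₀
  (suc i) → up (suc i) (m≤n⊔m N₀ N₁) (p₁ i)

eventually-all< : (P : ℕ → ℕ → Set) → (∀ v → UpwardClosed (P v)) →
                  ∀ V → (∀ v → v < V → ∃ (P v)) → ∃[ N ] ∀ v → v < V → P v N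
eventually-all< P up V ex with eventually-all (P ∘ toℕ) (up ∘ toℕ) (λ i → ex (toℕ i) (toℕ<n i))
... | N , p = N , λ v v<V → subst (λ v → P v N) (toℕ-fromℕ< v<V) (p (fromℕ< v<V))

bounded-Fin : ∀ {k} (g : Fin k → ℕ) → ∃[ B ] ∀ i → g i ≤ B
bounded-Fin g = eventually-all (λ i → g i ≤_) (λ _ le p → ≤-trans p le) (λ i → g i , ≤-refl)

bounded-< : ∀ (f : ℕ → ℕ) V → ∃[ B ] ∀ v → v < V → f v ≤ B
bounded-< f V = eventually-all< (λ v → f v ≤_) (λ _ le p → ≤-trans p le) V (λ v _ → f v , ≤-refl)

bounded-orbit⇒ReachesCycle : ∀ f n B → (∀ k → iter f k n ≤ B) → ReachesCycle f n
bounded-orbit⇒ReachesCycle f n B bound with pigeonhole (n<1+n (suc B)) (λ i → fromℕ< (s≤s (bound (toℕ i))))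
... | i , j , i<j , same = toℕ i , toℕ j ∸ toℕ i , m<n⇒0<n∸m i<j , (begin
  iter f (toℕ i + (toℕ j ∸ toℕ i)) n   ≡⟨ cong (λ k → iter f k n) (m+[n∸m]≡n (<⇒≤ i<j)) ⟩
  iter f (toℕ j) n                     ≡⟨ toℕ-fromℕ< _ ⟨
  toℕ (fromℕ< _)                       ≡⟨ cong toℕ same ⟨
  toℕ (fromℕ< _)                       ≡⟨ toℕ-fromℕ< _ ⟩
  iter f (toℕ i) n                     ∎)
  where open ≡-Reasoning

eventually-decreasing⇒ReachesCycle : ∀ f M → (∀ m → M < f m → f (f m) < f m) → ∀ n → ReachesCycle f n
eventually-decreasing⇒ReachesCycle f M decreasing n with bounded-< f (suc M)
... | F , f≤F = bounded-orbit⇒ReachesCycle f n (n ⊔ (f n ⊔ F)) bound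
  where
  bound′ : ∀ k → iter f (suc k) n ≤ f n ⊔ F
  bound′ zero    = m≤m⊔n (f n) F
  bound′ (suc k) with M <? iter f (suc k) n
  ... | yes large = ≤-trans (<⇒≤ (decreasing (iter f k n) large)) (bound′ k)
  ... | no  small = ≤-trans (f≤F _ (s≤s (≮⇒≥ small))) (m≤n⊔m (f n) F)
  bound : ∀ k → iter f k n ≤ n ⊔ (f n ⊔ F)
  bound zero    = m≤m⊔n n _
  bound (suc k) = ≤-trans (bound′ k) (m≤n⊔m n _)

-- Long equidistributed numbers decrease under S

p≤∣p∣ : ∀ p → p ℚ.≤ ℚ.∣ p ∣
p≤∣p∣ (ℚ.mkℚ (+ _)    _ _) = ℚ.≤-refl
p≤∣p∣ p@(ℚ.mkℚ -[1+ _ ] _ _) = ℚ.<⇒≤ (ℚ.neg<pos p ℚ.∣ p ∣)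

p-q<r⇒p<r+q : ∀ p q r → p ℚ.- q ℚ.< r → p ℚ.< r ℚ.+ q
p-q<r⇒p<r+q p q r p-q<r = subst (ℚ._< r ℚ.+ q) p-q+q≡p (ℚ.+-monoˡ-< q p-q<r)
  where
  p-q+q≡p : (p ℚ.- q) ℚ.+ q ≡ p
  p-q+q≡p = trans (ℚ.+-assoc p (ℚ.- q) q) (trans (cong (p ℚ.+_) (ℚ.+-inverseˡ q)) (ℚ.+-identityʳ p))

1/-pos : ∀ m .{{_ : NonZero m}} → Positive ((+ 1) ℚ./ m)
1/-pos m = ℚ.normalize-pos 1 m

ratio-close⇒count< : ∀ c D q k .{{_ : NonZero D}} .{{_ : NonZero q}} .{{_ : NonZero k}} →
  ℚ.∣ ratio c D ℚ.- ratio 1 q ∣ ℚ.< ((+ 1) ℚ./ (q * k)) {{m*n≢0 q k}} →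
  c * (q * k) < suc k * D
ratio-close⇒count< c (suc D′) (suc q′) (suc k′) close =
  *-cancelʳ-< q (c * (q * k)) (suc k * D) (subst₂ _<_ lhs rhs (ℤ.drop‿+<+ (subst₂ ℤ._<_ lhsℤ rhsℤ cross)))
  where
  q k D : ℕ
  q = suc q′
  k = suc k′
  D = suc D′
  ε : ℚ
  ε = (+ 1) ℚ./ (q * k)
  below : ratio c D ℚ.< ε ℚ.+ ratio 1 q
  below = p-q<r⇒p<r+q _ _ ε (ℚ.≤-<-trans (p≤∣p∣ _) close)
  belowᵘ : ℚᵘ.mkℚᵘ (+ c) D′ ℚᵘ.< ℚᵘ.mkℚᵘ (+ 1) (pred (q * k)) ℚᵘ.+ ℚᵘ.mkℚᵘ (+ 1) q′
  belowᵘ = ℚᵘ.<-respˡ-≃ (ℚ.toℚᵘ-fromℚᵘ (ℚᵘ.mkℚᵘ (+ c) D′))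
             (ℚᵘ.<-respʳ-≃ (ℚᵘ.≃-trans (ℚ.toℚᵘ-homo-+ ε (ratio 1 q))
                                       (ℚᵘ.+-cong (ℚ.toℚᵘ-fromℚᵘ (ℚᵘ.mkℚᵘ (+ 1) (pred (q * k))))
                                                  (ℚ.toℚᵘ-fromℚᵘ (ℚᵘ.mkℚᵘ (+ 1) q′))))
               (ℚ.toℚᵘ-mono-< below))
  cross : (+ c) ℤ.* (+ (q * k * q)) ℤ.< ((+ 1) ℤ.* (+ q) ℤ.+ (+ 1) ℤ.* (+ (q * k))) ℤ.* (+ D)
  cross = ℚᵘ.drop-*<* belowᵘ
  lhsℤ : (+ c) ℤ.* (+ (q * k * q)) ≡ + (c * (q * k * q))
  lhsℤ = sym (ℤ.pos-* c _)
  rhsℤ : ((+ 1) ℤ.* (+ q) ℤ.+ (+ 1) ℤ.* (+ (q * k))) ℤ.* (+ D) ≡ + ((q + q * k) * D)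
  rhsℤ = begin
    ((+ 1) ℤ.* (+ q) ℤ.+ (+ 1) ℤ.* (+ (q * k))) ℤ.* (+ D)
      ≡⟨ cong₂ (λ x y → (x ℤ.+ y) ℤ.* (+ D)) (ℤ.*-identityˡ (+ q)) (ℤ.*-identityˡ (+ (q * k))) ⟩
    ((+ q) ℤ.+ (+ (q * k))) ℤ.* (+ D)                     ≡⟨ cong (ℤ._* (+ D)) (ℤ.pos-+ q (q * k)) ⟨
    (+ (q + q * k)) ℤ.* (+ D)                            ≡⟨ ℤ.pos-* (q + q * k) D ⟨
    + ((q + q * k) * D)                                ∎
    where open ≡-Reasoning
  lhs : c * (q * k * q) ≡ c * (q * k) * q
  lhs = sym (*-assoc c (q * k) q)
  rhs : (q + q * k) * D ≡ suc k * D * q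
  rhs = identity q k D
    where
    identity : ∀ q k D → (q + q * k) * D ≡ (1 + k) * D * q
    identity = solve-∀

count : ℕ → List ℕ → ℕ
count d xs = length (filter (_≟ d) xs)

count-here : ∀ x xs → count x (x ∷ xs) ≡ suc (count x xs)
count-here x xs = cong length (filter-accept (_≟ x) refl)

count-there : ∀ {x d} xs → d ≢ x → count d (x ∷ xs) ≡ count d xs
count-there xs d≢x = cong length (filter-reject (_≟ _) (d≢x ∘′ sym))

powerProduct : ℕ → (ℕ → ℕ) → ℕ
powerProduct zero    g = 1
powerProduct (suc B) g = powerProduct B g * (B + 2) ^ g B

powerProduct-cong : ∀ B {g h} → (∀ {d} → d < B → g d ≡ h d) → powerProduct B g ≡ powerProduct B h
powerProduct-cong zero    _   = refl
powerProduct-cong (suc B) g≡h = cong₂ (λ x y → x * (B + 2) ^ y) (powerProduct-cong B (g≡h ∘ m<n⇒m<1+n)) (g≡h ≤-refl)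

powerProduct-zero : ∀ B → powerProduct B (λ _ → 0) ≡ 1
powerProduct-zero zero    = refl
powerProduct-zero (suc B) = cong (_* 1) (powerProduct-zero B)

powerProduct-bump : ∀ {B x g h} → x < B → h x ≡ suc (g x) → (∀ {d} → d ≢ x → h d ≡ g d) →
                    powerProduct B h ≡ (x + 2) * powerProduct B g
powerProduct-bump {suc B} {x} {g} {h} x<B hx ho with x ≟ B
... | yes refl = begin
  powerProduct x h * (x + 2) ^ h x
    ≡⟨ cong₂ (λ P e → P * (x + 2) ^ e) (powerProduct-cong x (ho ∘ <⇒≢)) hx ⟩
  powerProduct x g * ((x + 2) * (x + 2) ^ g x) ≡⟨ x∙yz≈y∙xz (powerProduct x g) (x + 2) _ ⟩
  (x + 2) * (powerProduct x g * (x + 2) ^ g x) ∎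
  where open ≡-Reasoning
... | no x≢B = begin
  powerProduct B h * (B + 2) ^ h B
    ≡⟨ cong₂ (λ P e → P * (B + 2) ^ e) (powerProduct-bump (≤∧≢⇒< (≤-pred x<B) x≢B) hx ho) (ho (x≢B ∘′ sym)) ⟩
  (x + 2) * powerProduct B g * (B + 2) ^ g B   ≡⟨ *-assoc (x + 2) _ _ ⟩
  (x + 2) * (powerProduct B g * (B + 2) ^ g B) ∎
  where open ≡-Reasoning

S₂≡powerProduct : ∀ B xs → All (_< B) xs → product (map (_+ 2) xs) ≡ powerProduct B (λ d → count d xs)
S₂≡powerProduct B []       []          = sym (powerProduct-zero B)
S₂≡powerProduct B (x ∷ xs) (x<B ∷ xs<B) =
  trans (cong ((x + 2) *_) (S₂≡powerProduct B xs xs<B))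
        (sym (powerProduct-bump x<B (count-here x xs) (count-there xs)))

^-distribʳ-* : ∀ a b m → (a * b) ^ m ≡ a ^ m * b ^ m
^-distribʳ-* a b zero    = refl
^-distribʳ-* a b (suc m) = trans (cong ((a * b) *_) (^-distribʳ-* a b m)) (interchange a b (a ^ m) (b ^ m))

powerProduct-^ : ∀ B g m → powerProduct B g ^ m ≡ powerProduct B (λ d → g d * m)
powerProduct-^ zero    g m = ^-zeroˡ m
powerProduct-^ (suc B) g m = begin
  (powerProduct B g * (B + 2) ^ g B) ^ m                ≡⟨ ^-distribʳ-* (powerProduct B g) _ m ⟩
  powerProduct B g ^ m * ((B + 2) ^ g B) ^ m            ≡⟨ cong₂ _*_ (powerProduct-^ B g m) (^-*-assoc (B + 2) (g B) m) ⟩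
  powerProduct B (λ d → g d * m) * (B + 2) ^ (g B * m) ∎
  where open ≡-Reasoning

powerProduct-mono : ∀ B {g h} → (∀ {d} → d < B → g d ≤ h d) → powerProduct B g ≤ powerProduct B h
powerProduct-mono zero    _   = ≤-refl
powerProduct-mono (suc B) g≤h =
  *-mono-≤ (powerProduct-mono B (g≤h ∘ m<n⇒m<1+n)) (^-monoʳ-≤ (B + 2) {{+2≢0}} (g≤h ≤-refl))
  where
  +2≢0 : NonZero (B + 2)
  +2≢0 = subst NonZero (+-comm 2 B) _

powerProduct-one : ∀ B → powerProduct B (λ _ → 1) ≡ suc B !
powerProduct-one zero    = refl
powerProduct-one (suc B) = begin
  powerProduct B (λ _ → 1) * (B + 2) ^ 1 ≡⟨ cong₂ _*_ (powerProduct-one B) (*-identityʳ (B + 2)) ⟩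
  suc B ! * (B + 2)                      ≡⟨ *-comm (suc B !) (B + 2) ⟩
  (B + 2) * suc B !                      ≡⟨ cong (_* suc B !) (+-comm B 2) ⟩
  suc (suc B) !                          ∎
  where open ≡-Reasoning

powerProduct-const : ∀ B m → powerProduct B (λ _ → m) ≡ (suc B !) ^ m
powerProduct-const B m = begin
  powerProduct B (λ _ → m)       ≡⟨ powerProduct-cong B (λ _ → sym (*-identityˡ m)) ⟩
  powerProduct B (λ _ → 1 * m)   ≡⟨ powerProduct-^ B (λ _ → 1) m ⟨
  powerProduct B (λ _ → 1) ^ m   ≡⟨ cong (_^ m) (powerProduct-one B) ⟩
  (suc B !) ^ m                    ∎
  where open ≡-Reasoning

bernoulli : ∀ a e → a ^ e * (a + e) ≤ suc a ^ e * a
bernoulli a zero    = ≤-reflexive (cong (_+ 0) (+-identityʳ a))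
bernoulli a (suc e) = begin
  a * a ^ e * (a + suc e)              ≡⟨ expand a (a ^ e) e ⟩
  a * X + a ^ e * a                    ≤⟨ +-monoʳ-≤ (a * X) (*-monoʳ-≤ (a ^ e) (m≤m+n a e)) ⟩
  a * X + X                            ≡⟨ +-comm (a * X) X ⟩
  suc a * X                            ≤⟨ *-monoʳ-≤ (suc a) (bernoulli a e) ⟩
  suc a * (suc a ^ e * a)              ≡⟨ *-assoc (suc a) (suc a ^ e) a ⟨
  suc a * suc a ^ e * a                ∎
  where
  open ≤-Reasoning
  X : ℕ
  X = a ^ e * (a + e)
  expand : ∀ a p e → a * p * (a + suc e) ≡ a * (p * (a + e)) + p * a
  expand = solve-∀

m^k*c<n^k : ∀ {m n} c {k} → 1 ≤ m → m < n → suc (c * m) ≤ k → m ^ k * c < n ^ k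
m^k*c<n^k {m} {n} c {k} 1≤m m<n k-large = *-cancelʳ-< m (m ^ k * c) (n ^ k) (begin-strict
  m ^ k * c * m   ≡⟨ *-assoc (m ^ k) c m ⟩
  m ^ k * (c * m) <⟨ *-monoʳ-< (m ^ k) (<-≤-trans k-large (m≤n+m k m)) ⟩
  m ^ k * (m + k) ≤⟨ bernoulli m k ⟩
  suc m ^ k * m   ≤⟨ *-monoˡ-≤ m (^-monoˡ-≤ k m<n) ⟩
  n ^ k * m       ∎)
  where
  open ≤-Reasoning
  instance
    mᵏ≢0 : NonZero (m ^ k)
    mᵏ≢0 = m^n≢0 m k {{>-nonZero 1≤m}}

n!≤m^pred-n : ∀ {n m} → n ≤ m → n ! ≤ m ^ pred n
n!≤m^pred-n {zero}        _   = ≤-refl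
n!≤m^pred-n {suc zero}    _   = ≤-refl
n!≤m^pred-n {suc (suc n)} n≤m = *-mono-≤ n≤m (n!≤m^pred-n (≤-trans (n≤1+n _) n≤m))

[1+b]!<b^b : ∀ {b} → 3 ≤ b → suc b ! < b ^ b
[1+b]!<b^b {suc (suc (suc c))} (s≤s (s≤s (s≤s _))) = begin-strict
  (4 + c) * ((3 + c) * ((2 + c) * (1 + c) !))
    ≤⟨ *-monoʳ-≤ (4 + c) (*-monoʳ-≤ (3 + c) (*-monoʳ-≤ (2 + c) (n!≤m^pred-n (m≤n+m (1 + c) 2)))) ⟩
  (4 + c) * ((3 + c) * ((2 + c) * P))         ≡⟨ regroup c P ⟩
  (4 + c) * (2 + c) * ((3 + c) * P)           <⟨ *-monoˡ-< ((3 + c) * P) (≤-reflexive (square c)) ⟩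
  (3 + c) * (3 + c) * ((3 + c) * P)           ≡⟨ *-assoc (3 + c) (3 + c) ((3 + c) * P) ⟩
  (3 + c) ^ (3 + c)                           ∎
  where
  open ≤-Reasoning
  P : ℕ
  P = (3 + c) ^ c
  instance
    [3+c]P≢0 : NonZero ((3 + c) * P)
    [3+c]P≢0 = m*n≢0 (3 + c) P {{_}} {{m^n≢0 (3 + c) c}}
  regroup : ∀ c P → (4 + c) * ((3 + c) * ((2 + c) * P)) ≡ (4 + c) * (2 + c) * ((3 + c) * P)
  regroup = solve-∀
  square : ∀ c → suc ((4 + c) * (2 + c)) ≡ (3 + c) * (3 + c)
  square = solve-∀

^-cancelˡ-< : ∀ b .{{_ : NonZero b}} {m n} → b ^ m < b ^ n → m < n
^-cancelˡ-< b {m} {n} bᵐ<bⁿ with m <? n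
... | yes m<n = m<n
... | no  m≮n = contradiction (^-monoʳ-≤ b (≮⇒≥ m≮n)) (<⇒≱ bᵐ<bⁿ)

^-cancelʳ-< : ∀ k {m n} → m ^ k < n ^ k → m < n
^-cancelʳ-< k {m} {n} mᵏ<nᵏ with m <? n
... | yes m<n = m<n
... | no  m≮n = contradiction (^-monoˡ-≤ k (≮⇒≥ m≮n)) (<⇒≱ mᵏ<nᵏ)

module _ {b} .{{_ : NonZero b}} (1<b : 1 < b) (factorial<power : suc b ! < b ^ b) where

  -- (b+1)! < b^b gives X < Y as soon as K > ((b+1)!)²; ε = 1/(bK)-equidistribution then bounds the
  -- number of occurrences of each digit in an (E+1)-digit number by (K+1)(E+1)/(bK).
  private
    Π K X Y : ℕ
    Π = suc b !
    K = suc (Π * Π)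
    X = Π ^ suc K
    Y = (b ^ b) ^ K

    instance
      bK≢0 : NonZero (b * K)
      bK≢0 = m*n≢0 b K

    1≤X : 1 ≤ X
    1≤X = m^n>0 Π {{>-nonZero (1≤n! (suc b))}} (suc K)

    X<Y : X < Y
    X<Y = subst (_< Y) (*-comm (Π ^ K) Π) (m^k*c<n^k Π (1≤n! (suc b)) factorial<power ≤-refl)

  S<-if-few-of-each-digit : ∀ w E → length (digits b w) ≡ suc E → suc (X * X) ≤ E →
    (∀ d → d < b → count d (digits b w) * (b * K) ≤ suc K * suc E) → S 2 b w < w
  S<-if-few-of-each-digit w E length≡ E-large few = ^-cancelʳ-< (b * K) (begin-strict
    S 2 b w ^ (b * K)                              ≡⟨ cong (_^ (b * K)) (S₂≡powerProduct b (digits b w) (digits-< b w)) ⟩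
    powerProduct b (λ d → count d ds) ^ (b * K)    ≡⟨ powerProduct-^ b _ (b * K) ⟩
    powerProduct b (λ d → count d ds * (b * K))    ≤⟨ powerProduct-mono b (few _) ⟩
    powerProduct b (λ _ → suc K * suc E)           ≡⟨ powerProduct-const b (suc K * suc E) ⟩
    Π ^ (suc K * suc E)                            ≡⟨ ^-*-assoc Π (suc K) (suc E) ⟨
    X ^ suc E                                      ≡⟨ *-comm X (X ^ E) ⟩
    X ^ E * X                                      <⟨ m^k*c<n^k X 1≤X X<Y E-large ⟩
    Y ^ E                                          ≡⟨ ^-*-assoc (b ^ b) K E ⟩
    (b ^ b) ^ (K * E)                              ≡⟨ ^-*-assoc b b (K * E) ⟩
    b ^ (b * (K * E))                              ≡⟨ cong (b ^_) (rearrange b K E) ⟩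
    b ^ (E * (b * K))                              ≡⟨ ^-*-assoc b E (b * K) ⟨
    (b ^ E) ^ (b * K)                              ≤⟨ ^-monoˡ-≤ (b * K) (b^pred-length-digits≤ 1<b w length≡) ⟩
    w ^ (b * K)                                    ∎)
    where
    open ≤-Reasoning
    ds : List ℕ
    ds = digits b w
    rearrange : ∀ b K E → b * (K * E) ≡ E * (b * K)
    rearrange = solve-∀

  -- Opaque: for a concrete b the threshold C is astronomically large and must never be normalised.
  opaque
    equidistributed⇒S< : ∃[ ε ] Positive ε × ∃[ C ] ∀ w → Equidistributed b ε w → C ≤ w → S 2 b w < w
    equidistributed⇒S< = ε , 1/-pos (b * K) , C , S<
      where
      ε : ℚ
      ε = (+ 1) ℚ./ (b * K)
      C : ℕ
      C = b ^ suc (X * X)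
      S< : ∀ w → Equidistributed b ε w → C ≤ w → S 2 b w < w
      S< w equi C≤w with length (digits b w) in length≡
      ... | zero  = contradiction (≤-trans (m^n>0 b (suc (X * X))) C≤w)
                                  (<⇒≱ (subst (λ L → w < b ^ L) length≡ (<b^length-digits 1<b w)))
      ... | suc E = S<-if-few-of-each-digit w E length≡ E-large few
        where
        E-large : suc (X * X) ≤ E
        E-large = ≤-pred (^-cancelˡ-< b (≤-<-trans C≤w (subst (λ L → w < b ^ L) length≡ (<b^length-digits 1<b w))))
        few : ∀ d → d < b → count d (digits b w) * (b * K) ≤ suc K * suc E
        few d d<b = <⇒≤ (ratio-close⇒count< (count d (digits b w)) (suc E) b K (equi d d<b))

-- Reduction to cofactors of powers of b

product-map-+2≤ : ∀ {B} xs → All (_< B) xs → product (map (_+ 2) xs) ≤ suc B ^ length xs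
product-map-+2≤ []       []           = ≤-refl
product-map-+2≤ {B} (x ∷ xs) (x<B ∷ xs<B) = *-mono-≤ (subst (_≤ suc B) (+-comm 2 x) (s≤s x<B)) (product-map-+2≤ xs xs<B)

module _ {b} .{{_ : NonZero b}} (2<b : 2 < b) where

  private
    1<b : 1 < b
    1<b = <-trans (s≤s (s≤s z≤n)) 2<b

  S₂≤ : ∀ w → S 2 b w ≤ suc b ^ w
  S₂≤ w = ≤-trans (product-map-+2≤ (digits b w) (digits-< b w)) (^-monoʳ-≤ (suc b) (length-digits≤ 1<b w))

  S₂-decreasing-on-multiples : (P : ℕ → Set) → ∃[ W ] (∀ w → P w → W ≤ w → S 2 b w < w) →
    ∃[ M ] ∀ u w → P w → 0 < w → M < b ^ u * w → S 2 b (b ^ u * w) < b ^ u * w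
  S₂-decreasing-on-multiples P (W , decreasing) = b ^ u₀ * W , S₂< 
    where
    u₀ : ℕ
    u₀ = suc (suc b ^ W * 2)
    S₂< : ∀ u w → P w → 0 < w → b ^ u₀ * W < b ^ u * w → S 2 b (b ^ u * w) < b ^ u * w
    S₂< u w Pw 0<w large with W ≤? w
    ... | yes W≤w = begin-strict
      S 2 b (b ^ u * w) ≡⟨ S-b^* 2 1<b u w ⟩
      2 ^ u * S 2 b w   <⟨ *-monoʳ-< (2 ^ u) (decreasing w Pw W≤w) ⟩
      2 ^ u * w         ≤⟨ *-monoˡ-≤ w (^-monoˡ-≤ u (<⇒≤ 2<b)) ⟩
      b ^ u * w         ∎
      where
      open ≤-Reasoning
      instance
        w≢0 : NonZero w
        w≢0 = >-nonZero 0<w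
        2ᵘ≢0 : NonZero (2 ^ u)
        2ᵘ≢0 = m^n≢0 2 u
    ... | no W≰w = begin-strict
      S 2 b (b ^ u * w)   ≡⟨ S-b^* 2 1<b u w ⟩
      2 ^ u * S 2 b w     ≤⟨ *-monoʳ-≤ (2 ^ u) (≤-trans (S₂≤ w) (^-monoʳ-≤ (suc b) (<⇒≤ w<W))) ⟩
      2 ^ u * suc b ^ W   <⟨ m^k*c<n^k (suc b ^ W) (s≤s z≤n) 2<b u₀≤u ⟩
      b ^ u               ≤⟨ m≤m*n (b ^ u) w ⟩
      b ^ u * w           ∎
      where
      open ≤-Reasoning
      instance
        w≢0 : NonZero w
        w≢0 = >-nonZero 0<w
      w<W : w < W
      w<W = ≰⇒> W≰w
      u₀≤u : u₀ ≤ u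
      u₀≤u with u₀ ≤? u
      ... | yes u₀≤u = u₀≤u
      ... | no  u₀≰u = contradiction large (≤⇒≯ (*-mono-≤ (^-monoʳ-≤ b (<⇒≤ (≰⇒> u₀≰u))) (<⇒≤ w<W)))

  reachesCycle-if-decreasing-on : (P : ℕ → Set) →
    (∀ m → ∃[ u ] ∃[ w ] (P w × 0 < w × S 2 b m ≡ b ^ u * w)) →
    ∃[ W ] (∀ w → P w → W ≤ w → S 2 b w < w) → ∀ n → ReachesCycle (S 2 b) n
  reachesCycle-if-decreasing-on P image-in-P decreasing-on-P
    with S₂-decreasing-on-multiples P decreasing-on-P
  ... | M , decreasing = eventually-decreasing⇒ReachesCycle (S 2 b) M S₂S₂<
    where
    S₂S₂< : ∀ m → M < S 2 b m → S 2 b (S 2 b m) < S 2 b m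
    S₂S₂< m large with image-in-P m
    ... | u , w , Pw , 0<w , S≡ = subst (λ s → S 2 b s < s) (sym S≡) (decreasing u w Pw 0<w (subst (M <_) S≡ large))

-- Products of prime powers

infixr 8 _^ᵛ_

_^ᵛ_ : ∀ {k} → (Fin k → ℕ) → (Fin k → ℕ) → ℕ
p ^ᵛ e = product (tabulate (λ i → p i ^ e i))

^ᵛ-cong : ∀ {k} (p : Fin k → ℕ) {e f} → (∀ i → e i ≡ f i) → p ^ᵛ e ≡ p ^ᵛ f
^ᵛ-cong p e≗f = cong product (tabulate-cong (cong (p _ ^_) ∘ e≗f))

^ᵛ-zero : ∀ {k} (p : Fin k → ℕ) → p ^ᵛ (λ _ → 0) ≡ 1
^ᵛ-zero {zero}  p = refl
^ᵛ-zero {suc k} p = cong (1 *_) (^ᵛ-zero (p ∘ suc))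

^ᵛ-+ : ∀ {k} (p : Fin k → ℕ) e f → p ^ᵛ (λ i → e i + f i) ≡ p ^ᵛ e * p ^ᵛ f
^ᵛ-+ {zero}  p e f = refl
^ᵛ-+ {suc k} p e f = begin
  p zero ^ (e zero + f zero) * (p ∘ suc) ^ᵛ (λ i → e (suc i) + f (suc i))
    ≡⟨ cong₂ _*_ (^-distribˡ-+-* (p zero) (e zero) (f zero)) (^ᵛ-+ (p ∘ suc) (e ∘ suc) (f ∘ suc)) ⟩
  p zero ^ e zero * p zero ^ f zero * ((p ∘ suc) ^ᵛ (e ∘ suc) * (p ∘ suc) ^ᵛ (f ∘ suc))
    ≡⟨ interchange (p zero ^ e zero) _ _ _ ⟩
  p zero ^ e zero * (p ∘ suc) ^ᵛ (e ∘ suc) * (p zero ^ f zero * (p ∘ suc) ^ᵛ (f ∘ suc)) ∎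
  where open ≡-Reasoning

^ᵛ-punchIn : ∀ {k} (p e : Fin (suc k) → ℕ) i → p ^ᵛ e ≡ p i ^ e i * (p ∘ punchIn i) ^ᵛ (e ∘ punchIn i)
^ᵛ-punchIn         p e zero    = refl
^ᵛ-punchIn {suc k} p e (suc i) = trans (cong (p zero ^ e zero *_) (^ᵛ-punchIn (p ∘ suc) (e ∘ suc) i))
                                        (x∙yz≈y∙xz (p zero ^ e zero) (p (suc i) ^ e (suc i)) _)

^ᵛ≢0 : ∀ {k} {p : Fin k → ℕ} → (∀ i → NonZero (p i)) → ∀ e → NonZero (p ^ᵛ e)
^ᵛ≢0 {zero}          _   _ = _
^ᵛ≢0 {suc k} {p} p≢0 e = m*n≢0 _ _ {{m^n≢0 (p zero) (e zero) {{p≢0 zero}}}} {{^ᵛ≢0 (p≢0 ∘ suc) (e ∘ suc)}}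

^ᵛ-mono : ∀ {k} {p : Fin k → ℕ} → (∀ i → NonZero (p i)) → ∀ {e f} → (∀ i → e i ≤ f i) → p ^ᵛ e ≤ p ^ᵛ f
^ᵛ-mono {zero}          _   _   = ≤-refl
^ᵛ-mono {suc k} {p} p≢0 e≤f =
  *-mono-≤ (^-monoʳ-≤ (p zero) {{p≢0 zero}} (e≤f zero)) (^ᵛ-mono (p≢0 ∘ suc) (e≤f ∘ suc))

^ᵛ-updateAt-suc : ∀ {k} (p e : Fin k → ℕ) i → p ^ᵛ updateAt e i suc ≡ p i * p ^ᵛ e
^ᵛ-updateAt-suc p e zero    = *-assoc (p zero) (p zero ^ e zero) _
^ᵛ-updateAt-suc p e (suc i) = trans (cong (p zero ^ e zero *_) (^ᵛ-updateAt-suc (p ∘ suc) (e ∘ suc) i))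
                                    (x∙yz≈y∙xz (p zero ^ e zero) (p (suc i)) _)

^ᵛ-divisible : ∀ {k} (p e : Fin k → ℕ) i → 0 < e i → p i ∣ p ^ᵛ e
^ᵛ-divisible {suc k} p e i 0<eᵢ = subst (p i ∣_) (sym (^ᵛ-punchIn p e i)) (∣m⇒∣m*n _ (∣^ (e i) 0<eᵢ))
  where
  ∣^ : ∀ m → 0 < m → p i ∣ p i ^ m
  ∣^ (suc m) _ = m∣m*n (p i ^ m)

^ᵛ-large⇒large-exponent : ∀ {k} {p : Fin k → ℕ} → (∀ i → NonZero (p i)) →
  ∀ B z → p ^ᵛ (λ _ → B) < p ^ᵛ z → ∃[ j ] B < z j
^ᵛ-large⇒large-exponent p≢0 B z large with any? (λ j → B <? z j)
... | yes exceeds = exceeds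
... | no  ¬exceeds = contradiction (^ᵛ-mono p≢0 (λ j → ≮⇒≥ (¬exceeds ∘ (j ,_)))) (<⇒≱ large)

module _ {k} (p : Fin k → ℕ) where

  Smooth : ℕ → Set
  Smooth n = ∃[ e ] n ≡ p ^ᵛ e

  smooth-1 : Smooth 1
  smooth-1 = (λ _ → 0) , sym (^ᵛ-zero p)

  smooth-* : ∀ {m n} → Smooth m → Smooth n → Smooth (m * n)
  smooth-* (e , m≡) (f , n≡) = (λ i → e i + f i) , trans (cong₂ _*_ m≡ n≡) (sym (^ᵛ-+ p e f))

  smooth-p* : ∀ i {n} → Smooth n → Smooth (p i * n)
  smooth-p* i (e , n≡) = updateAt e i suc , trans (cong (p i *_) n≡) (sym (^ᵛ-updateAt-suc p e i))

  smooth-p : ∀ i → Smooth (p i)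
  smooth-p i = subst Smooth (*-identityʳ (p i)) (smooth-p* i smooth-1)

  smooth-product : ∀ {xs} → All Smooth xs → Smooth (product xs)
  smooth-product []                    = smooth-1
  smooth-product (x-smooth ∷ xs-smooth) = smooth-* x-smooth (smooth-product xs-smooth)

module _ {k} {p : Fin k → ℕ} (p≢0 : ∀ i → NonZero (p i)) {β : Fin k → ℕ} (1<pᵝ : 1 < p ^ᵛ β) where

  private
    b : ℕ
    b = p ^ᵛ β

  Stripped : (Fin k → ℕ) → Set
  Stripped e = ∃[ u ] ∃[ z ] (p ^ᵛ e ≡ b ^ u * p ^ᵛ z × ∃[ i ] z i < β i)

  strip : ∀ e → Stripped e
  strip e = <-rec (λ n → ∀ e → p ^ᵛ e ≡ n → Stripped e) step (p ^ᵛ e) e refl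
    where
    step : ∀ n → (∀ {m} → m < n → ∀ e → p ^ᵛ e ≡ m → Stripped e) → ∀ e → p ^ᵛ e ≡ n → Stripped e
    step _ rec e refl with all? (λ i → β i ≤? e i)
    ... | no  ¬β≤e = 0 , e , sym (*-identityˡ (p ^ᵛ e)) , below (¬∀⟶∃¬ _ _ (λ i → β i ≤? e i) ¬β≤e)
      where
      below : ∃[ i ] ¬ β i ≤ e i → ∃[ i ] e i < β i
      below (i , βᵢ≰eᵢ) = i , ≰⇒> βᵢ≰eᵢ
    ... | yes β≤e = peel (rec smaller rest refl)
      where
      rest : Fin k → ℕ
      rest i = e i ∸ β i
      e≡b*rest : p ^ᵛ e ≡ b * p ^ᵛ rest
      e≡b*rest = trans (^ᵛ-cong p (λ i → sym (m+[n∸m]≡n (β≤e i)))) (^ᵛ-+ p β rest)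
      smaller : p ^ᵛ rest < p ^ᵛ e
      smaller = subst (p ^ᵛ rest <_) (trans (*-comm (p ^ᵛ rest) b) (sym e≡b*rest))
                      (m<m*n (p ^ᵛ rest) b {{^ᵛ≢0 p≢0 rest}} 1<pᵝ)
      peel : Stripped rest → Stripped e
      peel (u , z , rest≡ , small) = suc u , z , trans e≡b*rest (trans (cong (b *_) rest≡) (sym (*-assoc b (b ^ u) _))) , small

-- Base 3, under Conjecture A

S₂,₃-image : ∀ xs → All (_< 3) xs → ∃[ y ] ∃[ x ] product (map (_+ 2) xs) ≡ 3 ^ y * 2 ^ x
S₂,₃-image []       []           = 0 , 0 , refl
S₂,₃-image (d ∷ xs) (d<3 ∷ xs<3) with S₂,₃-image xs xs<3
... | y , x , eq with d | d<3
...   | 0 | _ = y , suc x , trans (cong (2 *_) eq) (x∙yz≈y∙xz 2 (3 ^ y) (2 ^ x))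
...   | 1 | _ = suc y , x , trans (cong (3 *_) eq) (sym (*-assoc 3 (3 ^ y) (2 ^ x)))
...   | 2 | _ = y , 2 + x , trans (cong (4 *_) eq)
                                   (trans (x∙yz≈y∙xz 4 (3 ^ y) (2 ^ x)) (cong (3 ^ y *_) (*-assoc 2 2 (2 ^ x))))
...   | suc (suc (suc _)) | s≤s (s≤s (s≤s ()))

S₂,₃-reachesCycle : ConjectureA → ∀ n → ReachesCycle (S 2 3) n
S₂,₃-reachesCycle conjA = reachesCycle-if-decreasing-on ≤-refl PowerOf2 image decreasing
  where
  PowerOf2 : ℕ → Set
  PowerOf2 w = ∃[ x ] w ≡ 2 ^ x

  image : ∀ m → ∃[ u ] ∃[ w ] (PowerOf2 w × 0 < w × S 2 3 m ≡ 3 ^ u * w)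
  image m with S₂,₃-image (digits 3 m) (digits-< 3 m)
  ... | y , x , eq = y , 2 ^ x , (x , refl) , m^n>0 2 x , eq

  3-not-only-2 : ¬ (∀ r → Prime r → r ∣ 3 → r ∈ 2 ∷ [])
  3-not-only-2 only-2 with only-2 3 (toWitness {a? = prime? 3} _) ∣-refl
  ... | here  ()
  ... | there ()

  decreasing : ∃[ W ] ∀ w → PowerOf2 w → W ≤ w → S 2 3 w < w
  decreasing with equidistributed⇒S< {3} (s≤s (s≤s z≤n)) ([1+b]!<b^b ≤-refl)
  ... | ε , ε>0 , C , S₂< with conjA 3 (s≤s (s≤s z≤n)) (2 ∷ []) (prime[2] ∷ []) 3-not-only-2 1 z<s (2 ^_) refl
                                    (λ k → 2 , here refl , *-comm 2 (2 ^ k)) ε ε>0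
  ...   | x₀ , equidistributed = C ⊔ 2 ^ x₀ , S₂<′
    where
    S₂<′ : ∀ w → PowerOf2 w → C ⊔ 2 ^ x₀ ≤ w → S 2 3 w < w
    S₂<′ _ (x , refl) large = S₂< (2 ^ x) (equidistributed x x₀≤x) (≤-trans (m≤m⊔n C (2 ^ x₀)) large)
      where
      x₀≤x : x₀ ≤ x
      x₀≤x = ≮⇒≥ (λ x<x₀ → <⇒≱ (^-monoʳ-< 2 (s≤s (s≤s z≤n)) x<x₀) (≤-trans (m≤n⊔m C (2 ^ x₀)) large))

-- Bases b ≥ 3, under Conjecture B

lookup-injective : ∀ {xs : List ℕ} → Unique xs → Injective _≡_ _≡_ (lookup xs)
lookup-injective {_ ∷ _} (_ ∷ _)  {zero}  {zero}  _  = refl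
lookup-injective {_ ∷ _} (x∉ ∷ _) {zero}  {suc j} eq = contradiction eq (All.lookup x∉ (∈-lookup j))
lookup-injective {_ ∷ _} (x∉ ∷ _) {suc i} {zero}  eq = contradiction (sym eq) (All.lookup x∉ (∈-lookup i))
lookup-injective {_ ∷ _} (_ ∷ u)  {suc i} {suc j} eq = cong suc (lookup-injective u eq)

primesUpTo : ℕ → List ℕ
primesUpTo n = filter prime? (upTo (suc n))

module _ (n : ℕ) where

  private
    p : Fin (length (primesUpTo n)) → ℕ
    p = lookup (primesUpTo n)

  primesUpTo-prime : ∀ i → Prime (p i)
  primesUpTo-prime i = proj₂ (∈-filter⁻ prime? {xs = upTo (suc n)} (∈-lookup i))

  primesUpTo-injective : Injective _≡_ _≡_ p
  primesUpTo-injective = lookup-injective (filter⁺ prime? (upTo⁺ (suc n)))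

  primesUpTo-complete : ∀ {r} → Prime r → r ≤ n → ∃[ i ] p i ≡ r
  primesUpTo-complete {r} r-prime r≤n = Any.index r∈ , sym (lookup-index r∈)
    where
    r∈ : r ∈ primesUpTo n
    r∈ = ∈-filter⁺ prime? (∈-upTo⁺ (s≤s r≤n)) r-prime

  smooth-≤ : ∀ {m} → 0 < m → m ≤ n → Smooth p m
  smooth-≤ {m} 0<m m≤n = subst (Smooth p) (sym m≡∏) (smooth-product p (All.tabulate factor-smooth))
    where
    instance
      m≢0 : NonZero m
      m≢0 = >-nonZero 0<m
    open PrimeFactorisation (factorise m)
    m≡∏ : m ≡ product factors
    m≡∏ = isFactorisation
    factor-smooth : ∀ {r} → r ∈ factors → Smooth p r
    factor-smooth r∈ with primesUpTo-complete (All.lookup factorsPrime r∈)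
                            (≤-trans (∣⇒≤ (subst (_ ∣_) (sym m≡∏) (∈⇒∣product r∈))) m≤n)
    ... | i , refl = smooth-p p i

-- Conjecture B for the primes other than p i₀, with a = (p i₀)^v: this is where p i₀ ∣ q is needed.
conjectureB-omitting : ConjectureB → ∀ {q} → 1 < q → ∀ {ε} → Positive ε →
  ∀ {k} {p : Fin k → ℕ} → Injective _≡_ _≡_ p → (∀ i → Prime (p i)) → ∀ i₀ → p i₀ ∣ q → ∀ v →
  ∃[ N ] ∀ z → z i₀ ≡ v → ∃[ j ] (i₀ ≢ j × N ≤ z j) → Equidistributed q ε (p ^ᵛ z)
conjectureB-omitting conjB {q} 1<q {ε} ε>0 {suc k} {p} p-injective p-prime i₀ pᵢ₀∣q v
  with conjB q 1<q k (p ∘ punchIn i₀) (punchIn-injective i₀ _ _ ∘ p-injective) (p-prime ∘ punchIn i₀)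
             pᵢ₀-omitted (p i₀ ^ v) (m^n>0 (p i₀) {{prime⇒nonZero (p-prime i₀)}} v) ε ε>0
  where
  pᵢ₀-omitted : ¬ (∀ r → Prime r → r ∣ q → ∃[ i ] p (punchIn i₀ i) ≡ r)
  pᵢ₀-omitted among-others with among-others (p i₀) (p-prime i₀) pᵢ₀∣q
  ... | i , eq = punchInᵢ≢i i₀ i (p-injective eq)
... | N , equidistributed = N , equidistributed′
  where
  equidistributed′ : ∀ z → z i₀ ≡ v → ∃[ j ] (i₀ ≢ j × N ≤ z j) → Equidistributed q ε (p ^ᵛ z)
  equidistributed′ z refl (j , i₀≢j , N≤zⱼ) =
    subst (Equidistributed q ε) (sym (^ᵛ-punchIn p z i₀))
      (equidistributed (z ∘ punchIn i₀) (punchOut i₀≢j , subst (λ t → N ≤ z t) (sym (punchIn-punchOut i₀≢j)) N≤zⱼ))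

module _ (conjB : ConjectureB) {b} (3≤b : 3 ≤ b) where

  private
    1<b : 1 < b
    1<b = ≤-trans (n≤1+n 2) 3≤b
    instance
      b≢0 : NonZero b
      b≢0 = >-nonZero (<-trans z<s 1<b)
    p : Fin (length (primesUpTo (suc b))) → ℕ
    p = lookup (primesUpTo (suc b))
    p≢0 : ∀ i → NonZero (p i)
    p≢0 i = prime⇒nonZero (primesUpTo-prime (suc b) i)
    b-smooth : Smooth p b
    b-smooth = smooth-≤ (suc b) (<-trans z<s 1<b) (n≤1+n b)
    β : Fin (length (primesUpTo (suc b))) → ℕ
    β = proj₁ b-smooth
    b≡pᵝ : b ≡ p ^ᵛ β
    b≡pᵝ = proj₂ b-smooth

  Reduced : ℕ → Set
  Reduced w = ∃[ z ] (w ≡ p ^ᵛ z × ∃[ i ] z i < β i)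

  S₂-image : ∀ m → ∃[ u ] ∃[ w ] (Reduced w × 0 < w × S 2 b m ≡ b ^ u * w)
  S₂-image m with S₂-smooth | strip p≢0 (subst (1 <_) b≡pᵝ 1<b) (proj₁ S₂-smooth)
    where
    S₂-smooth : Smooth p (S 2 b m)
    S₂-smooth = smooth-product p (All.map⁺ (All.map digit+2-smooth (digits-< b m)))
      where
      digit+2-smooth : ∀ {d} → d < b → Smooth p (d + 2)
      digit+2-smooth {d} d<b = smooth-≤ (suc b) (subst (0 <_) (+-comm 2 d) z<s) (subst (_≤ suc b) (+-comm 2 d) (s≤s d<b))
  ... | e , S≡pᵉ | u , z , pᵉ≡ , small =
    u , p ^ᵛ z , (z , refl , small) , >-nonZero⁻¹ _ {{^ᵛ≢0 p≢0 z}} ,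
    trans S≡pᵉ (trans pᵉ≡ (cong (λ x → x ^ u * p ^ᵛ z) (sym b≡pᵝ)))

  private
    Threshold : ℚ → Fin (length (primesUpTo (suc b))) → ℕ → ℕ → Set
    Threshold ε i v N = ∀ z → z i ≡ v → ∃[ j ] (i ≢ j × N ≤ z j) → Equidistributed b ε (p ^ᵛ z)

    Threshold-upward : ∀ {ε i v} → UpwardClosed (Threshold ε i v)
    Threshold-upward N≤N′ threshold z zᵢ≡v (j , i≢j , N′≤zⱼ) =
      threshold z zᵢ≡v (j , i≢j , ≤-trans N≤N′ N′≤zⱼ)

    uniform-threshold : ∀ {ε} → Positive ε → ∃[ N ] ∀ i v → v < β i → Threshold ε i v N
    uniform-threshold {ε} ε>0 =
      eventually-all (λ i N → ∀ v → v < β i → Threshold ε i v N)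
                     (λ i N≤N′ threshold v v<βᵢ → Threshold-upward N≤N′ (threshold v v<βᵢ))
                     (λ i → eventually-all< (Threshold ε i) (λ v → Threshold-upward) (β i) (threshold-at i))
      where
      threshold-at : ∀ i v → v < β i → ∃ (Threshold ε i v)
      threshold-at i v v<βᵢ =
        conjectureB-omitting conjB 1<b ε>0 (primesUpTo-injective (suc b)) (primesUpTo-prime (suc b)) i
          (subst (p i ∣_) (sym b≡pᵝ) (^ᵛ-divisible p β i (≤-<-trans z≤n v<βᵢ))) v

  S₂-decreasing-on-Reduced : ∃[ W ] ∀ w → Reduced w → W ≤ w → S 2 b w < w
  S₂-decreasing-on-Reduced with equidistributed⇒S< 1<b ([1+b]!<b^b 3≤b)
  ... | ε , ε>0 , C , S₂< with uniform-threshold ε>0 | bounded-Fin β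
  ...   | N , equidistributed | B , β≤B = suc (C ⊔ p ^ᵛ (λ _ → N ⊔ B)) , S₂<′
    where
    S₂<′ : ∀ w → Reduced w → suc (C ⊔ p ^ᵛ (λ _ → N ⊔ B)) ≤ w → S 2 b w < w
    S₂<′ _ (z , refl , i₀ , zᵢ₀<βᵢ₀) large
      with ^ᵛ-large⇒large-exponent p≢0 (N ⊔ B) z (≤-trans (s≤s (m≤n⊔m C _)) large)
    ... | j , N⊔B<zⱼ =
      S₂< (p ^ᵛ z) (equidistributed i₀ (z i₀) zᵢ₀<βᵢ₀ z refl (j , i₀≢j , ≤-trans (m≤m⊔n N B) (<⇒≤ N⊔B<zⱼ)))
          (≤-trans (m≤m⊔n C _) (<⇒≤ large))
      where
      i₀≢j : i₀ ≢ j
      i₀≢j refl = <-asym zᵢ₀<βᵢ₀ (≤-<-trans (≤-trans (β≤B i₀) (m≤n⊔m N B)) N⊔B<zⱼ)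

  S₂-reachesCycle : ∀ n → ReachesCycle (S 2 b) n
  S₂-reachesCycle = reachesCycle-if-decreasing-on 3≤b Reduced S₂-image S₂-decreasing-on-Reduced

theorem15 : (ConjectureA → (n : ℕ) → 1 ≤ n → ReachesCycle (S 2 3) n)
          × (ConjectureB → (b : ℕ) → 4 ≤ b → (n : ℕ) → 1 ≤ n → ReachesCycle (S 2 b) n)
theorem15 = (λ conjA n _ → S₂,₃-reachesCycle conjA n)
          , (λ conjB b 4≤b n _ → S₂-reachesCycle conjB (≤-trans (n≤1+n 3) 4≤b) n)
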